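{- Let $G$ and $H$ be nontrivial graphs, let $v\in V(H)$ be a root, and let $f$ be a Roman dominating function on $G\circ_v H$ of weight $\gamma_R(G\circ_v H)$. Then for every vertex $x\in V(G)$: (i) $\omega(f_x)\geq \gamma_R(H)-1$; and (ii) if $\omega(f_x)=\gamma_R(H)-1$, then $f(x)=0$ and $f(S)\leq 1$, where $S=N_{G\circ_v H}(x)\cap V(H_x)$.
   Context: All graphs are finite and simple; a graph is nontrivial if it has at least two vertices. For a nontrivial graph $G$ and a nontrivial graph $H$ with a root $v\in V(H)$, the rooted product graph $G\circ_v H$ is obtained by taking one copy of $G$ and $n(G)=|V(G)|$ copies of $H$, and identifying the $i$-th vertex of $G$ with the vertex $v$ in the $i$-th copy of $H$, for each $i$. For $x\in V(G)$, $H_x$ denotes the copy of $H$ containing $x$, and for a function $f$ on $V(G\circ_v H)$, $f_x$ denotes its restriction to $V(H_x)$. For $f:V(X)\to\{0,1,2\}$ and $S\subseteq V(X)$, $f(S)=\sum_{u\in S}f(u)$ and $\omega(f)=f(V(X))$. $f$ is a Roman dominating function (RDF) if every vertex with value $0$ has a neighbor with value $2$; $\gamma_R(X)$ is the minimum weight of an RDF on $X$. $N_X(x)$ is the open neighborhood of $x$ in $X$. -}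

module Defs where

open import Data.Nat using (ℕ; zero; suc; _+_; _≤_)
open import Data.Fin using (Fin; toℕ; _≟_)
open import Data.Bool using (Bool; true; false; if_then_else_; _∧_; _∨_)
open import Data.List using (List; map)
open import Data.Nat.ListAction using (sum)
open import Data.List.Base using (allFin)
open import Data.Product using (_×_; _,_; Σ; ∃; proj₁; proj₂)
open import Relation.Nullary.Decidable using (⌊_⌋)
open import Relation.Binary.PropositionalEquality using (_≡_)

record Graph (n : ℕ) : Set where
  field
    adj    : Fin n → Fin n → Bool
    sym    : ∀ i j → adj i j ≡ adj j i
    irrefl : ∀ i → adj i i ≡ false
open Graph public

Nontrivial : ℕ → Set
Nontrivial n = 2 ≤ n

Σ[_] : ∀ n → (Fin n → ℕ) → ℕ
Σ[ n ] g = sum (map g (allFin n))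

IsRDF : {V : Set} → (V → V → Bool) → (V → Fin 3) → Set
IsRDF {V} a f = ∀ u → toℕ (f u) ≡ 0 → Σ V (λ w → (a u w ≡ true) × (toℕ (f w) ≡ 2))

ω : ∀ n → (Fin n → Fin 3) → ℕ
ω n f = Σ[ n ] (λ i → toℕ (f i))

IsγR : ∀ {n} → Graph n → ℕ → Set
IsγR {n} H k =
  Σ (Fin n → Fin 3) (λ g → IsRDF (adj H) g × (ω n g ≡ k))
  × (∀ g → IsRDF (adj H) g → k ≤ ω n g)

-- Rooted product G ∘_v H: vertices (i , h) with i ∈ V(G), h ∈ V(H);
-- the i-th vertex of G is identified with (i , v).
-- (i,h) ~ (j,h')  iff  (i = j and h ~_H h')  or  (h = v, h' = v and i ~_G j)
RPAdj : ∀ {nG nH} → Graph nG → Graph nH → Fin nH →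
        Fin nG × Fin nH → Fin nG × Fin nH → Bool
RPAdj G H v (i , h) (j , h') =
  (⌊ i ≟ j ⌋ ∧ adj H h h') ∨ ((⌊ h ≟ v ⌋ ∧ ⌊ h' ≟ v ⌋) ∧ adj G i j)

ωRP : ∀ nG nH → (Fin nG × Fin nH → Fin 3) → ℕ
ωRP nG nH f = Σ[ nG ] (λ i → Σ[ nH ] (λ h → toℕ (f (i , h))))

IsγRFunRP : ∀ {nG nH} → Graph nG → Graph nH → Fin nH →
            (Fin nG × Fin nH → Fin 3) → Set
IsγRFunRP {nG} {nH} G H v f =
  IsRDF (RPAdj G H v) f × (∀ g → IsRDF (RPAdj G H v) g → ωRP nG nH f ≤ ωRP nG nH g)

restr : ∀ {nG nH} → (Fin nG × Fin nH → Fin 3) → Fin nG → Fin nH → Fin 3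
restr f x h = f (x , h)

-- f(S) for S = N_{G∘_v H}(x) ∩ V(H_x) = { (x , h) : h ~_H v }
fNbrInHx : ∀ {nG nH} → Graph nH → Fin nH → (Fin nG × Fin nH → Fin 3) → Fin nG → ℕ
fNbrInHx {nG} {nH} H v f x =
  Σ[ nH ] (λ h → if adj H v h then toℕ (f (x , h)) else 0)

-- Restricted to the copy H_x, a Roman dominating function f of G ∘_v H still dominates every
-- vertex of H other than the root, because only the root has neighbours outside H_x. Raising
-- f(x) to at least 1 therefore yields an RDF of H, so γ_R(H) ≤ ω(f_x) + 1, with no loss when
-- f(x) ≠ 0. If ω(f_x) = γ_R(H) − 1, then f(x) = 0, and no neighbour of the root carries a 2
-- (otherwise f_x itself would be an RDF of H); placing 2 on the root and 0 on its neighbours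
-- then gives an RDF of H of weight at most ω(f_x) + 2 − f(S), whence f(S) ≤ 1.
module Submission where

open import Defs renaming (sym to adj-sym)
open import Data.Nat using (ℕ; zero; suc; _+_; _≤_; _<_; _∸_; z≤n; s≤s)
open import Data.Nat.Properties
  using (+-0-commutativeMonoid; +-assoc; +-mono-≤; +-monoʳ-≤; +-cancelˡ-≤; ≤-refl; ≤-trans; ≤-reflexive;
         m≤m+n; n≤1+n; +-identityʳ; +-comm; +-monoˡ-≤; ∸-monoʳ-<; <⇒≱; m≤n+o⇒m∸n≤o; module ≤-Reasoning)
import Data.Nat.ListAction as List
open import Data.Fin using (Fin; zero; suc; toℕ; punchIn; _≟_)
open import Data.Fin.Patterns using (0F; 1F; 2F)
open import Data.Fin.Properties using (punchInᵢ≢i; any?)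
open import Data.Vec.Functional using (Vector; removeAt; updateAt)
open import Data.Vec.Functional.Properties using (updateAt-updates; updateAt-minimal)
open import Algebra.Properties.CommutativeMonoid.Sum +-0-commutativeMonoid using (sum; sum-remove; ∑-distrib-+)
open import Data.List.Base using (tabulate)
open import Data.List.Properties using (map-tabulate)
open import Data.Bool using (Bool; true; false; if_then_else_)
import Data.Bool.Properties as Bool
open import Data.Product using (_×_; _,_; Σ; proj₂)
open import Function using (_∘_; id; const)
open import Relation.Binary.PropositionalEquality using (_≡_; _≢_; refl; sym; trans; cong; cong₂; subst)
open import Relation.Nullary using (yes; no; contradiction)
open import Relation.Nullary.Decidable using (_×-dec_)
import Data.Nat.Properties as ℕ

private
  variable
    n : ℕ

Σ≡sum : ∀ n (g : Fin n → ℕ) → Σ[ n ] g ≡ sum g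
Σ≡sum n g = trans (cong List.sum (map-tabulate id g)) (sum-tabulate g)
  where
  sum-tabulate : ∀ {n} (g : Fin n → ℕ) → List.sum (tabulate g) ≡ sum g
  sum-tabulate {zero}  g = refl
  sum-tabulate {suc n} g = cong (g zero +_) (sum-tabulate (g ∘ suc))

sum-mono : {a b : Vector ℕ n} → (∀ i → a i ≤ b i) → sum a ≤ sum b
sum-mono {zero}  a≤b = z≤n
sum-mono {suc n} a≤b = +-mono-≤ (a≤b zero) (sum-mono (a≤b ∘ suc))

sum-mono-except : {a b : Vector ℕ n} {c : ℕ} (i : Fin n) →
                  (∀ j → j ≢ i → a j ≤ b j) → a i ≤ c + b i → sum a ≤ c + sum b
sum-mono-except {suc n} {a} {b} {c} i a≤b aᵢ≤ = begin
  sum a                              ≡⟨ sum-remove {i = i} a ⟩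
  a i + sum (removeAt a i)           ≤⟨ +-mono-≤ aᵢ≤ (sum-mono λ j → a≤b (punchIn i j) (punchInᵢ≢i i j)) ⟩
  c + b i + sum (removeAt b i)       ≡⟨ +-assoc c (b i) _ ⟩
  c + (b i + sum (removeAt b i))     ≡⟨ cong (c +_) (sym (sum-remove {i = i} b)) ⟩
  c + sum b                          ∎
  where open ≤-Reasoning

sum-term : (a : Vector ℕ n) (i : Fin n) → a i ≤ sum a
sum-term {suc n} a i = ≤-trans (m≤m+n (a i) _) (≤-reflexive (sym (sum-remove {i = i} a)))

RomanDominated : {V : Set} → (V → V → Bool) → (V → Fin 3) → V → Set
RomanDominated {V} a g u = toℕ (g u) ≡ 0 → Σ V (λ w → (a u w ≡ true) × (toℕ (g w) ≡ 2))

IsRDFExcept : Graph n → Fin n → (Fin n → Fin 3) → Set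
IsRDFExcept H v g = ∀ h → h ≢ v → RomanDominated (adj H) g h

isRDFExcept⇒isRDF : {H : Graph n} {v : Fin n} {g : Fin n → Fin 3} →
                    IsRDFExcept H v g → RomanDominated (adj H) g v → IsRDF (adj H) g
isRDFExcept⇒isRDF {v = v} g-rdf v-dominated h with h ≟ v
... | yes refl = v-dominated
... | no h≢v   = g-rdf h h≢v

RPAdj-off-root : ∀ {nG nH} (G : Graph nG) (H : Graph nH) {v h h' : Fin nH} {x j : Fin nG} →
                 h ≢ v → RPAdj G H v (x , h) (j , h') ≡ true → x ≡ j × adj H h h' ≡ true
RPAdj-off-root G H {v} {h} {h'} {x} {j} h≢v x,h~j,h' with x ≟ j | h ≟ v
... | _       | yes h≡v = contradiction h≡v h≢v
... | yes x≡j | no _    = x≡j , trans (sym (Bool.∨-identityʳ _)) x,h~j,h'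
... | no _    | no _    = contradiction x,h~j,h' λ ()

restr-isRDFExcept : ∀ {nG nH} (G : Graph nG) (H : Graph nH) (v : Fin nH) {f : Fin nG × Fin nH → Fin 3} →
                    IsRDF (RPAdj G H v) f → ∀ x → IsRDFExcept H v (restr f x)
restr-isRDFExcept G H v f-rdf x h h≢v fxh≡0 with f-rdf (x , h) fxh≡0
... | (j , h') , x,h~j,h' , fjh'≡2 with RPAdj-off-root G H h≢v x,h~j,h'
...   | refl , h~h' = h' , h~h' , fjh'≡2

updateAt-preserves : {A : Set} (P : A → Set) {f : A → A} (xs : Vector A n) (i j : Fin n) →
                     (∀ a → P a → P (f a)) → P (xs j) → P (updateAt xs i f j)
updateAt-preserves P xs i j f-preserves Pxⱼ with j ≟ i
... | yes refl = subst P (sym (updateAt-updates i xs)) (f-preserves _ Pxⱼ)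
... | no j≢i   = subst P (sym (updateAt-minimal j i xs j≢i)) Pxⱼ

ω-updateAt : (g : Fin n → Fin 3) (v : Fin n) (f : Fin 3 → Fin 3) {c : ℕ} →
             toℕ (f (g v)) ≤ c + toℕ (g v) → ω n (updateAt g v f) ≤ c + ω n g
ω-updateAt {n} g v f {c} fgv≤ = begin
  ω n (updateAt g v f)          ≡⟨ Σ≡sum n _ ⟩
  sum (toℕ ∘ updateAt g v f)    ≤⟨ sum-mono-except v unchanged updated ⟩
  c + sum (toℕ ∘ g)             ≡⟨ cong (c +_) (sym (Σ≡sum n _)) ⟩
  c + ω n g                     ∎
  where
  open ≤-Reasoning
  unchanged : ∀ h → h ≢ v → toℕ (updateAt g v f h) ≤ toℕ (g h)
  unchanged h h≢v = ≤-reflexive (cong toℕ (updateAt-minimal h v g h≢v))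
  updated : toℕ (updateAt g v f v) ≤ c + toℕ (g v)
  updated = subst (λ a → toℕ a ≤ c + toℕ (g v)) (sym (updateAt-updates v g)) fgv≤

ω-term : (g : Fin n → Fin 3) (i : Fin n) → toℕ (g i) ≤ ω n g
ω-term {n} g i = subst (toℕ (g i) ≤_) (sym (Σ≡sum n _)) (sum-term (toℕ ∘ g) i)

γR-pos : {H : Graph n} {k : ℕ} → IsγR H k → Fin n → 0 < k
γR-pos {n} ((g , g-rdf , refl) , _) v with toℕ (g v) in gv≡ | ω-term g v
... | zero  | _    = let (w , _ , gw≡2) = g-rdf v gv≡
                     in ≤-trans (s≤s z≤n) (subst (_≤ ω n g) gw≡2 (ω-term g w))
... | suc _ | gv≤ω = ≤-trans (s≤s z≤n) gv≤ω

atLeast1 : Fin 3 → Fin 3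
atLeast1 zero        = 1F
atLeast1 a@(suc _)   = a

atLeast1≢0 : ∀ a → toℕ (atLeast1 a) ≢ 0
atLeast1≢0 zero    ()
atLeast1≢0 (suc _) ()

atLeast1-≤ : ∀ a → toℕ (atLeast1 a) ≤ 1 + toℕ a
atLeast1-≤ zero    = ≤-refl
atLeast1-≤ (suc a) = n≤1+n _

atLeast1-2 : ∀ a → toℕ a ≡ 2 → toℕ (atLeast1 a) ≡ 2
atLeast1-2 (suc _) a≡2 = a≡2

atLeast1-nonzero : ∀ a → toℕ a ≢ 0 → atLeast1 a ≡ a
atLeast1-nonzero zero    a≢0 = contradiction refl a≢0
atLeast1-nonzero (suc _) _   = refl

raiseRoot : Fin n → (Fin n → Fin 3) → Fin n → Fin 3
raiseRoot v g = updateAt g v atLeast1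

starAt : Graph n → Fin n → (Fin n → Fin 3) → Fin n → Fin 3
starAt H v g = updateAt (λ h → if adj H v h then 0F else g h) v (const 2F)

starAt-root : (H : Graph n) (v : Fin n) (g : Fin n → Fin 3) → starAt H v g v ≡ 2F
starAt-root H v g = updateAt-updates v _

starAt-off-root : (H : Graph n) {v h : Fin n} (g : Fin n → Fin 3) → h ≢ v →
                  starAt H v g h ≡ (if adj H v h then 0F else g h)
starAt-off-root H {v} {h} g h≢v = updateAt-minimal h v _ h≢v

ωNbr : Graph n → Fin n → (Fin n → Fin 3) → ℕ
ωNbr {n} H v g = Σ[ n ] (λ h → if adj H v h then toℕ (g h) else 0)

ω-starAt : (H : Graph n) (v : Fin n) (g : Fin n → Fin 3) → ω n (starAt H v g) + ωNbr H v g ≤ 2 + ω n g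
ω-starAt {n} H v g = begin
  ω n (starAt H v g) + ωNbr H v g              ≡⟨ cong₂ _+_ (Σ≡sum n _) (Σ≡sum n _) ⟩
  sum (toℕ ∘ starAt H v g) + sum onNbrs        ≡⟨ sym (∑-distrib-+ (toℕ ∘ starAt H v g) onNbrs) ⟩
  sum (λ h → toℕ (starAt H v g h) + onNbrs h)  ≤⟨ sum-mono-except v off-root at-root ⟩
  2 + sum (toℕ ∘ g)                            ≡⟨ cong (2 +_) (sym (Σ≡sum n _)) ⟩
  2 + ω n g                                    ∎
  where
  open ≤-Reasoning
  onNbrs : Fin n → ℕ
  onNbrs h = if adj H v h then toℕ (g h) else 0
  off-root : ∀ h → h ≢ v → toℕ (starAt H v g h) + onNbrs h ≤ toℕ (g h)
  off-root h h≢v rewrite starAt-off-root H g h≢v with adj H v h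
  ... | true  = ≤-refl
  ... | false = ≤-reflexive (+-identityʳ _)
  at-root : toℕ (starAt H v g v) + onNbrs v ≤ 2 + toℕ (g v)
  at-root rewrite starAt-root H v g | irrefl H v = +-monoʳ-≤ 2 z≤n

module _ (H : Graph n) (v : Fin n) {g : Fin n → Fin 3} (g-rdf : IsRDFExcept H v g) where

  raiseRoot-isRDF : IsRDF (adj H) (raiseRoot v g)
  raiseRoot-isRDF h g'h≡0 with h ≟ v
  ... | yes refl = contradiction (subst (λ a → toℕ a ≡ 0) (updateAt-updates v g) g'h≡0) (atLeast1≢0 (g v))
  ... | no h≢v with g-rdf h h≢v (subst (λ a → toℕ a ≡ 0) (updateAt-minimal h v g h≢v) g'h≡0)
  ...   | w , h~w , gw≡2 = w , h~w , updateAt-preserves (λ a → toℕ a ≡ 2) g v w atLeast1-2 gw≡2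

  starAt-isRDF : (∀ w → adj H v w ≡ true → toℕ (g w) ≢ 2) → IsRDF (adj H) (starAt H v g)
  starAt-isRDF no2Nbr h s-h≡0 with h ≟ v
  ... | yes refl = contradiction (subst (λ a → toℕ a ≡ 0) (starAt-root H v g) s-h≡0) λ ()
  ... | no h≢v   = off-root (subst (λ a → toℕ a ≡ 0) (starAt-off-root H g h≢v) s-h≡0)
    where
    keeps2 : ∀ w → toℕ (g w) ≡ 2 → toℕ (starAt H v g w) ≡ 2
    keeps2 w gw≡2 = updateAt-preserves (λ a → toℕ a ≡ 2) _ v w (λ _ _ → refl) (unzeroed (adj H v w) refl)
      where
      unzeroed : ∀ b → adj H v w ≡ b → toℕ (if b then 0F else g w) ≡ 2
      unzeroed true  v~w = contradiction gw≡2 (no2Nbr w v~w)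
      unzeroed false _   = gw≡2
    off-root : toℕ (if adj H v h then 0F else g h) ≡ 0 →
               Σ (Fin n) (λ w → (adj H h w ≡ true) × (toℕ (starAt H v g w) ≡ 2))
    off-root with adj H v h in v~h
    ... | true  = λ _ → v , trans (adj-sym H h v) v~h , cong toℕ (starAt-root H v g)
    ... | false = λ gh≡0 → let (w , h~w , gw≡2) = g-rdf h h≢v gh≡0 in w , h~w , keeps2 w gw≡2

  module _ {k : ℕ} (γ : IsγR H k) where

    private
      γR-min : ∀ g' → IsRDF (adj H) g' → k ≤ ω n g'
      γR-min = proj₂ γ

    γR≤1+ω : k ≤ 1 + ω n g
    γR≤1+ω = ≤-trans (γR-min _ raiseRoot-isRDF) (ω-updateAt g v atLeast1 (atLeast1-≤ (g v)))

    ω<γR⇒root≡0 : ω n g < k → toℕ (g v) ≡ 0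
    ω<γR⇒root≡0 ω<k with toℕ (g v) ℕ.≟ 0
    ... | yes gv≡0 = gv≡0
    ... | no gv≢0  = contradiction (≤-trans (γR-min _ raiseRoot-isRDF) raised-ω) (<⇒≱ ω<k)
      where
      raised-ω : ω n (raiseRoot v g) ≤ 0 + ω n g
      raised-ω = ω-updateAt g v atLeast1 (≤-reflexive (cong toℕ (atLeast1-nonzero (g v) gv≢0)))

    ω<γR⇒ωNbr≤1 : ω n g < k → ωNbr H v g ≤ 1
    ω<γR⇒ωNbr≤1 ω<k with any? (λ w → (adj H v w Bool.≟ true) ×-dec (toℕ (g w) ℕ.≟ 2))
    ... | yes (w , v~w , gw≡2) =
      contradiction (γR-min g (isRDFExcept⇒isRDF {H = H} g-rdf λ _ → w , v~w , gw≡2)) (<⇒≱ ω<k)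
    ... | no ∄2Nbr = +-cancelˡ-≤ k _ _ (begin
      k + ωNbr H v g                   ≤⟨ +-monoˡ-≤ _ (γR-min _ (starAt-isRDF λ w v~w gw≡2 → ∄2Nbr (w , v~w , gw≡2))) ⟩
      ω n (starAt H v g) + ωNbr H v g  ≤⟨ ω-starAt H v g ⟩
      2 + ω n g                        ≤⟨ s≤s ω<k ⟩
      1 + k                            ≡⟨ +-comm 1 k ⟩
      k + 1                            ∎)
      where open ≤-Reasoning

lemma3p3 : ∀ {nG nH} (G : Graph nG) (H : Graph nH) (v : Fin nH) →
    Nontrivial nG → Nontrivial nH →
    (f : Fin nG × Fin nH → Fin 3) → IsγRFunRP G H v f →
    (γH : ℕ) → IsγR H γH →
    (x : Fin nG) →
      (γH ∸ 1 ≤ ω nH (restr f x))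
      × (ω nH (restr f x) ≡ γH ∸ 1 →
           (toℕ (f (x , v)) ≡ 0) × (fNbrInHx H v f x ≤ 1))
lemma3p3 {nH = nH} G H v _ _ f (f-rdf , _) k γ x = γR∸1≤ωfₓ , equality-case
  where
  fₓ-rdf : IsRDFExcept H v (restr f x)
  fₓ-rdf = restr-isRDFExcept G H v f-rdf x

  γR∸1≤ωfₓ : k ∸ 1 ≤ ω nH (restr f x)
  γR∸1≤ωfₓ = m≤n+o⇒m∸n≤o k 1 (γR≤1+ω H v fₓ-rdf γ)

  equality-case : ω nH (restr f x) ≡ k ∸ 1 → (toℕ (f (x , v)) ≡ 0) × (ωNbr H v (restr f x) ≤ 1)
  equality-case ωfₓ≡k∸1 = ω<γR⇒root≡0 H v fₓ-rdf γ ωfₓ<k , ω<γR⇒ωNbr≤1 H v fₓ-rdf γ ωfₓ<k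
    where
    ωfₓ<k : ω nH (restr f x) < k
    ωfₓ<k = subst (_< k) (sym ωfₓ≡k∸1) (∸-monoʳ-< (s≤s z≤n) (γR-pos {H = H} γ v))
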